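{- Let $s\ge1$. If $\Gamma$ is a simplicial complex and $x\in V(\Gamma)$ is not contained in any $s$-dimensional face of $\Gamma$, then $\bar{\zeta_s}\zeta_s(\Gamma)=\epsilon(\Gamma)$.
   Context: $V(\Gamma)$ is the vertex set; $\Gamma_A=\{X\cap A:X\in\Gamma\}$; a face $X$ has dimension $|X|-1$. $\zeta_s(\Gamma)=1$ if $\dim\Gamma<s$ and $0$ otherwise; $\bar{\zeta_s}(\Gamma)=(-1)^{|V(\Gamma)|}\zeta_s(\Gamma)$; $\bar{\zeta_s}\zeta_s(\Gamma)=\sum_{A\uplus B=V(\Gamma)}\bar{\zeta_s}(\Gamma_A)\zeta_s(\Gamma_B)$ over ordered pairs of disjoint sets with union $V(\Gamma)$. $\epsilon(\Gamma)=1$ if $\Gamma$ has no vertices and $0$ otherwise. -}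

module Defs where

open import Data.Bool using (Bool; true; false; T; not; _∧_; _∨_; if_then_else_)
open import Data.Nat using (ℕ; zero; suc; _≤ᵇ_; _≡ᵇ_)
open import Data.Fin using (Fin)
open import Data.Fin.Subset using (Subset; ⁅_⁆; _∈_; _⊆_; _∩_; _─_; ∣_∣)
open import Data.Fin.Subset.Properties using (_⊆?_)
open import Data.Integer using (ℤ; -_; _+_; _*_; 0ℤ; 1ℤ)
open import Data.List using (List; []; _∷_; map; _++_; foldr; filter)
open import Data.Bool.ListAction using (any; all)
open import Data.Vec using (Vec; []; _∷_; tabulate)
open import Data.Vec.Properties using (≡-dec)
import Data.Bool.Properties as BP
open import Relation.Nullary.Decidable using (⌊_⌋)

allSubsets : (n : ℕ) → List (Subset n)
allSubsets zero = [] ∷ []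
allSubsets (suc n) = map (true ∷_) (allSubsets n) ++ map (false ∷_) (allSubsets n)

Family : ℕ → Set
Family n = Subset n → Bool

record SimplicialComplex (n : ℕ) : Set where
  field
    face        : Family n
    down-closed : ∀ {X Y : Subset n} → Y ⊆ X → T (face X) → T (face Y)
open SimplicialComplex public

V : ∀ {n} → Family n → Subset n
V F = tabulate (λ v → F ⁅ v ⁆)

restrict : ∀ {n} → Family n → Subset n → Family n
restrict {n} F A Y = any (λ X → F X ∧ ⌊ ≡-dec BP._≟_ (X ∩ A) Y ⌋) (allSubsets n)

-- dim F < s  iff every face X has |X| - 1 < s, i.e. |X| ≤ s.
dimLt : ∀ {n} → ℕ → Family n → Bool
dimLt {n} s F = all (λ X → not (F X) ∨ (∣ X ∣ ≤ᵇ s)) (allSubsets n)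

ζ : ∀ {n} → ℕ → Family n → ℤ
ζ s F = if dimLt s F then 1ℤ else 0ℤ

sign : ℕ → ℤ
sign zero = 1ℤ
sign (suc k) = - sign k

ζbar : ∀ {n} → ℕ → Family n → ℤ
ζbar s F = sign ∣ V F ∣ * ζ s F

sumℤ : List ℤ → ℤ
sumℤ = foldr _+_ 0ℤ

-- (ζ̄_s ζ_s)(F) = Σ_{A ⊎ B = V(F)} ζ̄_s(F_A) ζ_s(F_B),
-- ordered pairs (A , B) of disjoint sets with union V(F), i.e. A ⊆ V(F), B = V(F) ─ A.
ζbarζ : ∀ {n} → ℕ → Family n → ℤ
ζbarζ {n} s F =
  sumℤ (map (λ A → ζbar s (restrict F A) * ζ s (restrict F (V F ─ A)))
            (filter (λ A → A ⊆? V F) (allSubsets n)))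

ε : ∀ {n} → Family n → ℤ
ε F = if ∣ V F ∣ ≡ᵇ 0 then 1ℤ else 0ℤ

-- Toggling the vertex x in A is a sign-reversing involution on the terms of
-- ζ̄_s ζ_s(Γ): it flips the parity of |A| (as V(Γ_A) = A) but preserves both
-- conditions dim Γ_A < s and dim Γ_{V ─ A} < s.  The only way adding x could
-- create a face of Γ_A of size s + 1 is from a face X ∋ x with |X ∩ A| = s,
-- and then X ∩ (A ∪ {x}) would be an s-dimensional face of Γ containing x.
-- The terms cancel in pairs, and ε(Γ) = 0 since x is a vertex.
module Submission where

open import Defs
open import Data.Bool using (Bool; true; false; T; not; _∧_; _∨_; if_then_else_)
open import Data.Bool.Properties using (T-≡; T-∧; ⇔→≡)
open import Data.Nat using (ℕ; zero; suc; _≤_; _≤ᵇ_)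
open import Data.Nat.Properties using (≤-trans; ≤∧≢⇒<; ≤ᵇ⇒≤; ≤⇒≤ᵇ)
open import Data.Fin using (Fin; zero; suc)
import Data.Fin.Properties as Fin
open import Data.Fin.Subset using (Subset; _∈_; _∉_; _⊆_; _∩_; _─_; ∣_∣; ⁅_⁆)
open import Data.Fin.Subset.Properties
  using (_∈?_; _⊆?_; ⊆-antisym; p∩q⊆p; x∈p∩q⁺; x∈p∩q⁻; x∈⁅x⁆; x∈⁅y⁆⇒x≡y;
         p⊆q⇒∣p∣≤∣q∣; x∈p⇒∣p-x∣<∣p∣)
open import Data.Integer using (ℤ; -_; _+_; _*_; 0ℤ; 1ℤ)
open import Data.Integer.Properties
  using (+-assoc; +-identityˡ; +-inverseˡ; neg-distrib-+; neg-involutive; neg-distribˡ-*)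
open import Data.List using (List; []; _∷_; map; _++_; filter)
open import Data.List.Properties using (map-++; map-cong; map-∘)
open import Data.List.Membership.Propositional using (lose) renaming (_∈_ to _∈ₗ_)
open import Data.List.Membership.Propositional.Properties using (∈-map⁺; ∈-++⁺ˡ; ∈-++⁺ʳ)
import Data.List.Relation.Unary.All as All
open import Data.List.Relation.Unary.All.Properties using (all⁺; all⁻)
open import Data.List.Relation.Unary.Any using (here; satisfied)
open import Data.List.Relation.Unary.Any.Properties using (any⁺; any⁻)
open import Data.Vec using ([]; _∷_; here; there)
open import Data.Vec.Properties using ([]=⇒lookup; lookup⇒[]=; lookup∘tabulate)
open import Data.Product using (∃; _×_; _,_; proj₁; proj₂)
open import Data.Empty using (⊥-elim)
open import Function using (_∘_; _⇔_; mk⇔; Equivalence)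
import Function.Properties.Equivalence as ⇔
open import Relation.Nullary using (¬_; yes; no; does)
open import Relation.Nullary.Decidable using (toWitness; fromWitness)
open import Relation.Unary using (Pred; Decidable)
open import Relation.Binary.PropositionalEquality

∈-allSubsets : ∀ {n} (A : Subset n) → A ∈ₗ allSubsets n
∈-allSubsets []          = here refl
∈-allSubsets (true ∷ A)  = ∈-++⁺ˡ (∈-map⁺ (true ∷_) (∈-allSubsets A))
∈-allSubsets {suc n} (false ∷ A) =
  ∈-++⁺ʳ (map (true ∷_) (allSubsets n)) (∈-map⁺ (false ∷_) (∈-allSubsets A))

sumℤ-++ : ∀ (xs ys : List ℤ) → sumℤ (xs ++ ys) ≡ sumℤ xs + sumℤ ys
sumℤ-++ []       ys = sym (+-identityˡ _)
sumℤ-++ (x ∷ xs) ys = trans (cong (x +_) (sumℤ-++ xs ys)) (sym (+-assoc x _ _))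

sumℤ-map-neg : ∀ {A : Set} (g : A → ℤ) xs → sumℤ (map (-_ ∘ g) xs) ≡ - sumℤ (map g xs)
sumℤ-map-neg g []       = refl
sumℤ-map-neg g (x ∷ xs) = trans (cong (- g x +_) (sumℤ-map-neg g xs)) (sym (neg-distrib-+ (g x) _))

sumℤ-map-filter : ∀ {A : Set} {p} {P : Pred A p} (P? : Decidable P) (f : A → ℤ) xs →
  sumℤ (map f (filter P? xs)) ≡ sumℤ (map (λ a → if does (P? a) then f a else 0ℤ) xs)
sumℤ-map-filter P? f [] = refl
sumℤ-map-filter P? f (a ∷ xs) with P? a
... | yes _ = cong (f a +_) (sumℤ-map-filter P? f xs)
... | no  _ = trans (sumℤ-map-filter P? f xs) (sym (+-identityˡ _))

sumℤ-allSubsets-suc : ∀ {n} (h : Subset (suc n) → ℤ) →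
  sumℤ (map h (allSubsets (suc n))) ≡
  sumℤ (map (h ∘ (true ∷_)) (allSubsets n)) + sumℤ (map (h ∘ (false ∷_)) (allSubsets n))
sumℤ-allSubsets-suc {n} h = begin
  sumℤ (map h (map (true ∷_) S ++ map (false ∷_) S))
    ≡⟨ cong sumℤ (map-++ h (map (true ∷_) S) (map (false ∷_) S)) ⟩
  sumℤ (map h (map (true ∷_) S) ++ map h (map (false ∷_) S))
    ≡⟨ sumℤ-++ (map h (map (true ∷_) S)) (map h (map (false ∷_) S)) ⟩
  sumℤ (map h (map (true ∷_) S)) + sumℤ (map h (map (false ∷_) S))
    ≡⟨ sym (cong₂ _+_ (cong sumℤ (map-∘ S)) (cong sumℤ (map-∘ S))) ⟩
  sumℤ (map (h ∘ (true ∷_)) S) + sumℤ (map (h ∘ (false ∷_)) S) ∎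
  where
  open ≡-Reasoning
  S = allSubsets n

toggle : ∀ {n} → Fin n → Subset n → Subset n
toggle zero    (b ∷ A) = not b ∷ A
toggle (suc x) (b ∷ A) = b ∷ toggle x A

sumℤ-allSubsets-toggle-antisym : ∀ {n} (x : Fin n) (h : Subset n → ℤ) →
  (∀ A → h (toggle x A) ≡ - h A) → sumℤ (map h (allSubsets n)) ≡ 0ℤ
sumℤ-allSubsets-toggle-antisym {suc n} zero h antisym = begin
  sumℤ (map h (allSubsets (suc n)))
    ≡⟨ sumℤ-allSubsets-suc h ⟩
  sumℤ (map (h ∘ (true ∷_)) S) + sumℤ (map (h ∘ (false ∷_)) S)
    ≡⟨ cong (_+ sumℤ (map (h ∘ (false ∷_)) S)) (cong sumℤ (map-cong (antisym ∘ (false ∷_)) S)) ⟩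
  sumℤ (map (-_ ∘ h ∘ (false ∷_)) S) + sumℤ (map (h ∘ (false ∷_)) S)
    ≡⟨ cong (_+ sumℤ (map (h ∘ (false ∷_)) S)) (sumℤ-map-neg (h ∘ (false ∷_)) S) ⟩
  - sumℤ (map (h ∘ (false ∷_)) S) + sumℤ (map (h ∘ (false ∷_)) S)
    ≡⟨ +-inverseˡ (sumℤ (map (h ∘ (false ∷_)) S)) ⟩
  0ℤ ∎
  where
  open ≡-Reasoning
  S = allSubsets n
sumℤ-allSubsets-toggle-antisym {suc n} (suc x) h antisym = begin
  sumℤ (map h (allSubsets (suc n)))
    ≡⟨ sumℤ-allSubsets-suc h ⟩
  sumℤ (map (h ∘ (true ∷_)) S) + sumℤ (map (h ∘ (false ∷_)) S)
    ≡⟨ cong₂ _+_ (sumℤ-allSubsets-toggle-antisym x (h ∘ (true ∷_)) (antisym ∘ (true ∷_)))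
                 (sumℤ-allSubsets-toggle-antisym x (h ∘ (false ∷_)) (antisym ∘ (false ∷_))) ⟩
  0ℤ ∎
  where
  open ≡-Reasoning
  S = allSubsets n

toggle-involutive : ∀ {n} (x : Fin n) A → toggle x (toggle x A) ≡ A
toggle-involutive zero    (true ∷ A)  = refl
toggle-involutive zero    (false ∷ A) = refl
toggle-involutive (suc x) (b ∷ A)     = cong (b ∷_) (toggle-involutive x A)

y≢x∧y∈toggle⇒y∈A : ∀ {n} {x y : Fin n} {A} → y ≢ x → y ∈ toggle x A → y ∈ A
y≢x∧y∈toggle⇒y∈A {x = zero}  {zero}           y≢x _           = ⊥-elim (y≢x refl)
y≢x∧y∈toggle⇒y∈A {x = zero}  {suc y} {b ∷ A} y≢x (there y∈)  = there y∈
y≢x∧y∈toggle⇒y∈A {x = suc x} {zero}  {b ∷ A} y≢x here        = here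
y≢x∧y∈toggle⇒y∈A {x = suc x} {suc y} {b ∷ A} y≢x (there y∈)  =
  there (y≢x∧y∈toggle⇒y∈A (y≢x ∘ cong suc) y∈)

x∈A⇒x∉toggle : ∀ {n} {x : Fin n} {A} → x ∈ A → x ∉ toggle x A
x∈A⇒x∉toggle {x = zero}  here       ()
x∈A⇒x∉toggle {x = suc x} (there x∈) (there x∈′) = x∈A⇒x∉toggle x∈ x∈′

x∉A⇒x∈toggle : ∀ {n} {x : Fin n} {A} → x ∉ A → x ∈ toggle x A
x∉A⇒x∈toggle {x = zero}  {true ∷ A}  x∉ = ⊥-elim (x∉ here)
x∉A⇒x∈toggle {x = zero}  {false ∷ A} x∉ = here
x∉A⇒x∈toggle {x = suc x} {b ∷ A}     x∉ = there (x∉A⇒x∈toggle (x∉ ∘ there))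

x∉A⇒∣toggle∣≡suc : ∀ {n} {x : Fin n} {A} → x ∉ A → ∣ toggle x A ∣ ≡ suc ∣ A ∣
x∉A⇒∣toggle∣≡suc {x = zero}  {true ∷ A}  x∉ = ⊥-elim (x∉ here)
x∉A⇒∣toggle∣≡suc {x = zero}  {false ∷ A} x∉ = refl
x∉A⇒∣toggle∣≡suc {x = suc x} {true ∷ A}  x∉ = cong suc (x∉A⇒∣toggle∣≡suc (x∉ ∘ there))
x∉A⇒∣toggle∣≡suc {x = suc x} {false ∷ A} x∉ = x∉A⇒∣toggle∣≡suc (x∉ ∘ there)

sign-∣toggle∣ : ∀ {n} (x : Fin n) A → sign ∣ toggle x A ∣ ≡ - sign ∣ A ∣
sign-∣toggle∣ zero    (true ∷ A)  = sym (neg-involutive _)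
sign-∣toggle∣ zero    (false ∷ A) = refl
sign-∣toggle∣ (suc x) (true ∷ A)  = cong -_ (sign-∣toggle∣ x A)
sign-∣toggle∣ (suc x) (false ∷ A) = sign-∣toggle∣ x A

∩-toggle : ∀ {n} {x : Fin n} {X} A → x ∈ X → X ∩ toggle x A ≡ toggle x (X ∩ A)
∩-toggle {x = zero}  (b ∷ A) here = refl
∩-toggle {x = suc x} {c ∷ X} (b ∷ A) (there x∈) = cong (c ∧ b ∷_) (∩-toggle A x∈)

─-toggle : ∀ {n} {x : Fin n} {W} A → x ∈ W → W ─ toggle x A ≡ toggle x (W ─ A)
─-toggle {x = zero}  (true ∷ A)  here = refl
─-toggle {x = zero}  (false ∷ A) here = refl
─-toggle {x = suc x} {c ∷ W} (true ∷ A)  (there x∈) = cong (false ∷_) (─-toggle A x∈)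
─-toggle {x = suc x} {c ∷ W} (false ∷ A) (there x∈) = cong (c ∷_) (─-toggle A x∈)

∩-toggle-⊆ : ∀ {n} {x : Fin n} X A → ¬ (x ∈ X × x ∉ A) → X ∩ toggle x A ⊆ X ∩ A
∩-toggle-⊆ {x = x} X A ¬x∈X∖A {y} y∈ with x∈p∩q⁻ X (toggle x A) y∈
... | y∈X , y∈toggle with y Fin.≟ x
...   | no  y≢x  = x∈p∩q⁺ (y∈X , y≢x∧y∈toggle⇒y∈A y≢x y∈toggle)
...   | yes refl with x ∈? A
...     | yes x∈A = ⊥-elim (x∈A⇒x∉toggle x∈A y∈toggle)
...     | no  x∉A = ⊥-elim (¬x∈X∖A (y∈X , x∉A))

toggle-⊆ : ∀ {n} {x : Fin n} {A W} → x ∈ W → A ⊆ W → toggle x A ⊆ W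
toggle-⊆ {x = x} x∈W A⊆W {y} y∈ with y Fin.≟ x
... | yes refl = x∈W
... | no  y≢x  = A⊆W (y≢x∧y∈toggle⇒y∈A y≢x y∈)

∈V⁺ : ∀ {n} {F : Family n} {v} → T (F ⁅ v ⁆) → v ∈ V F
∈V⁺ {F = F} {v} t = lookup⇒[]= v (V F) (trans (lookup∘tabulate _ v) (Equivalence.to T-≡ t))

∈V⁻ : ∀ {n} {F : Family n} {v} → v ∈ V F → T (F ⁅ v ⁆)
∈V⁻ {F = F} {v} v∈ = Equivalence.from T-≡ (trans (sym (lookup∘tabulate _ v)) ([]=⇒lookup v∈))

x∈p⇒⁅x⁆∩p≡⁅x⁆ : ∀ {n} {x : Fin n} {p} → x ∈ p → ⁅ x ⁆ ∩ p ≡ ⁅ x ⁆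
x∈p⇒⁅x⁆∩p≡⁅x⁆ {x = x} {p} x∈p = ⊆-antisym (p∩q⊆p ⁅ x ⁆ p)
  (λ y∈⁅x⁆ → x∈p∩q⁺ (y∈⁅x⁆ , subst (_∈ p) (sym (x∈⁅y⁆⇒x≡y x y∈⁅x⁆)) x∈p))

restrict⁺ : ∀ {n} {F : Family n} {A X Y} → T (F X) → X ∩ A ≡ Y → T (restrict F A Y)
restrict⁺ {X = X} FX refl =
  any⁺ _ (lose (∈-allSubsets X) (Equivalence.from T-∧ (FX , fromWitness refl)))

restrict⁻ : ∀ {n} {F : Family n} {A Y} → T (restrict F A Y) → ∃ λ X → T (F X) × X ∩ A ≡ Y
restrict⁻ {n} {F} t with satisfied (any⁻ _ (allSubsets n) t)
... | X , FX∧≡ with Equivalence.to (T-∧ {F X}) FX∧≡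
...   | FX , ≡Y = X , FX , toWitness ≡Y

V-restrict : ∀ {n} (F : Family n) {A} → A ⊆ V F → V (restrict F A) ≡ A
V-restrict F {A} A⊆V = ⊆-antisym V⊆A A⊆V′
  where
  V⊆A : V (restrict F A) ⊆ A
  V⊆A {v} v∈ with restrict⁻ {F = F} (∈V⁻ {F = restrict F A} v∈)
  ... | X , _ , X∩A≡⁅v⁆ = proj₂ (x∈p∩q⁻ X A (subst (v ∈_) (sym X∩A≡⁅v⁆) (x∈⁅x⁆ v)))
  A⊆V′ : A ⊆ V (restrict F A)
  A⊆V′ v∈A = ∈V⁺ {F = restrict F A} (restrict⁺ {F = F} (∈V⁻ {F = F} (A⊆V v∈A)) (x∈p⇒⁅x⁆∩p≡⁅x⁆ v∈A))

TraceBounded : ∀ {n} → ℕ → Family n → Subset n → Set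
TraceBounded s F A = ∀ X → T (F X) → ∣ X ∩ A ∣ ≤ s

dimLt-restrict⇔TraceBounded : ∀ {n} s (F : Family n) A →
  T (dimLt s (restrict F A)) ⇔ TraceBounded s F A
dimLt-restrict⇔TraceBounded {n} s F A = mk⇔ to from
  where
  small? : Subset n → Bool
  small? Y = not (restrict F A Y) ∨ (∣ Y ∣ ≤ᵇ s)

  to : T (dimLt s (restrict F A)) → TraceBounded s F A
  to dim X FX = ≤ᵇ⇒≤ _ s (subst (λ b → T (not b ∨ (∣ X ∩ A ∣ ≤ᵇ s)))
    (Equivalence.to T-≡ (restrict⁺ {F = F} FX refl))
    (All.lookup (all⁺ small? (allSubsets n) dim) (∈-allSubsets (X ∩ A))))

  small : TraceBounded s F A → ∀ Y → T (small? Y)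
  small bounded Y with restrict F A Y in eq
  ... | false = _
  ... | true with restrict⁻ {F = F} (Equivalence.from T-≡ eq)
  ...   | X , FX , refl = ≤⇒≤ᵇ (bounded X FX)

  from : TraceBounded s F A → T (dimLt s (restrict F A))
  from bounded = all⁻ small? (All.universal (small bounded) (allSubsets n))

ζ-restrict-cong : ∀ {n} s (F : Family n) {A B} →
  (TraceBounded s F A ⇔ TraceBounded s F B) → ζ s (restrict F A) ≡ ζ s (restrict F B)
ζ-restrict-cong s F {A} {B} A⇔B = cong (λ b → if b then 1ℤ else 0ℤ) (⇔→≡ {z = true}
  (⇔.trans (⇔.sym T-≡) (⇔.trans (dimLt-restrict⇔TraceBounded s F A)
    (⇔.trans A⇔B (⇔.trans (⇔.sym (dimLt-restrict⇔TraceBounded s F B)) T-≡)))))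

ε-vertex : ∀ {n} {F : Family n} {x} → x ∈ V F → ε F ≡ 0ℤ
ε-vertex {F = F} x∈V with ∣ V F ∣ | x∈p⇒∣p-x∣<∣p∣ x∈V
... | suc _ | _ = refl

module _ {n s} (Γ : SimplicialComplex n) {x : Fin n} (x∈V : x ∈ V (face Γ))
         (x∉s-face : ∀ X → T (face Γ X) → x ∈ X → ∣ X ∣ ≢ suc s) where

  private
    F = face Γ
    W = V F

  TraceBounded-toggle : ∀ {A} → TraceBounded s F A → TraceBounded s F (toggle x A)
  TraceBounded-toggle {A} bounded X FX with x ∈? X | x ∈? A
  ... | yes x∈X | no x∉A = subst (_≤ s) (sym ∣Y∣≡) (≤∧≢⇒< (bounded X FX) ∣X∩A∣≢s)
    where
    Y = X ∩ toggle x A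
    ∣Y∣≡ : ∣ Y ∣ ≡ suc ∣ X ∩ A ∣
    ∣Y∣≡ = trans (cong ∣_∣ (∩-toggle A x∈X)) (x∉A⇒∣toggle∣≡suc (x∉A ∘ proj₂ ∘ x∈p∩q⁻ X A))
    ∣X∩A∣≢s : ∣ X ∩ A ∣ ≢ s
    ∣X∩A∣≢s eq = x∉s-face Y (down-closed Γ (p∩q⊆p X (toggle x A)) FX)
      (x∈p∩q⁺ (x∈X , x∉A⇒x∈toggle x∉A)) (trans ∣Y∣≡ (cong suc eq))
  ... | yes x∈X | yes x∈A =
    ≤-trans (p⊆q⇒∣p∣≤∣q∣ (∩-toggle-⊆ X A (λ (_ , x∉A) → x∉A x∈A))) (bounded X FX)
  ... | no x∉X | _ = ≤-trans (p⊆q⇒∣p∣≤∣q∣ (∩-toggle-⊆ X A (x∉X ∘ proj₁))) (bounded X FX)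

  ζ-restrict-toggle : ∀ A → ζ s (restrict F (toggle x A)) ≡ ζ s (restrict F A)
  ζ-restrict-toggle A = ζ-restrict-cong s F (mk⇔
    (subst (TraceBounded s F) (toggle-involutive x A) ∘ TraceBounded-toggle)
    TraceBounded-toggle)

  term : Subset n → ℤ
  term A = ζbar s (restrict F A) * ζ s (restrict F (W ─ A))

  term-toggle : ∀ {A} → A ⊆ W → term (toggle x A) ≡ - term A
  term-toggle {A} A⊆W = begin
    sign ∣ V (restrict F (toggle x A)) ∣ * ζ s (restrict F (toggle x A)) * ζ s (restrict F (W ─ toggle x A))
      ≡⟨ cong₂ (λ B C → sign ∣ B ∣ * ζ s (restrict F (toggle x A)) * ζ s (restrict F C))
               (V-restrict F (toggle-⊆ x∈V A⊆W)) (─-toggle A x∈V) ⟩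
    sign ∣ toggle x A ∣ * ζ s (restrict F (toggle x A)) * ζ s (restrict F (toggle x (W ─ A)))
      ≡⟨ cong₂ _*_ (cong₂ _*_ (sign-∣toggle∣ x A) (ζ-restrict-toggle A)) (ζ-restrict-toggle (W ─ A)) ⟩
    - sign ∣ A ∣ * ζA * ζW─A
      ≡⟨ cong (_* ζW─A) (sym (neg-distribˡ-* (sign ∣ A ∣) ζA)) ⟩
    - (sign ∣ A ∣ * ζA) * ζW─A
      ≡⟨ sym (neg-distribˡ-* (sign ∣ A ∣ * ζA) ζW─A) ⟩
    - (sign ∣ A ∣ * ζA * ζW─A)
      ≡⟨ cong (λ B → - (sign ∣ B ∣ * ζA * ζW─A)) (sym (V-restrict F A⊆W)) ⟩
    - term A ∎
    where
    open ≡-Reasoning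
    ζA = ζ s (restrict F A)
    ζW─A = ζ s (restrict F (W ─ A))

  summand : Subset n → ℤ
  summand A = if does (A ⊆? W) then term A else 0ℤ

  summand-toggle : ∀ A → summand (toggle x A) ≡ - summand A
  summand-toggle A with A ⊆? W | toggle x A ⊆? W
  ... | yes A⊆W | yes _  = term-toggle A⊆W
  ... | no  _   | no  _  = refl
  ... | yes A⊆W | no  ¬⊆ = ⊥-elim (¬⊆ (toggle-⊆ x∈V A⊆W))
  ... | no  ¬⊆  | yes ⊆W = ⊥-elim (¬⊆ (subst (_⊆ W) (toggle-involutive x A) (toggle-⊆ x∈V ⊆W)))

  ζbarζ≡0 : ζbarζ s F ≡ 0ℤ
  ζbarζ≡0 = trans (sumℤ-map-filter (_⊆? W) term (allSubsets n))
                  (sumℤ-allSubsets-toggle-antisym x summand summand-toggle)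

lemma6p6 : ∀ {n : ℕ} (s : ℕ) → 1 ≤ s → (Γ : SimplicialComplex n) (x : Fin n) →
    x ∈ V (face Γ) →
    (∀ (X : Subset n) → T (face Γ X) → x ∈ X → ∣ X ∣ ≢ suc s) →
    ζbarζ s (face Γ) ≡ ε (face Γ)
lemma6p6 s _ Γ x x∈V x∉s-face = trans (ζbarζ≡0 Γ x∈V x∉s-face) (sym (ε-vertex {F = face Γ} x∈V))
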